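{- Let $E$ be a system of SQEMA-equations each of the form $\mathbf{j}\rightarrow\beta$, where $\mathbf{j}$ is a nominal and $\beta$ is a Sahlqvist antecedent (of $\mathrm{ML}^+$) built without using $\vee$ except possibly inside negative formulae. Let $p$ be a propositional variable occurring both positively and negatively in $E$. Then, using only the $\wedge$-rule, the $\Diamond$-rule, the (left-shift) $\Box$-rule and the Ackermann-rule, $E$ can be transformed into a system $E'$ not containing $p$, all of whose equations are again of the form $\mathbf{j}\rightarrow\beta$ with $\mathbf{j}$ a nominal and $\beta$ a Sahlqvist antecedent built without $\vee$ except possibly inside negative formulae.
   Context: $\mathrm{ML}^+$: formulae from $\top,\bot$, propositional variables and nominals (variables denoting singletons) with $\neg,\wedge,\vee,\Diamond,\Box,\Diamond^{ -1},\Box^{ -1}$. A formula is positive (negative) in $p$ if every occurrence of $p$ is in the scope of an even (odd) number of negations; a formula is negative if negative in every propositional variable (nominals are disregarded, so pure formulae, containing no propositional variables, are negative). A boxed atom is a propositional variable prefixed by finitely many (possibly zero) $\Box$'s. A Sahlqvist antecedent is a formula built from $\top$, $\bot$, boxed atoms and negative formulae using $\wedge$, $\vee$ and $\Diamond$. A SQEMA-equation is a formula $\alpha\rightarrow\beta$ of $\mathrm{ML}^+$; a system is a finite set of equations. The rules: $\wedge$-rule: $\beta\rightarrow\gamma\wedge\delta$ is replaced by $\beta\rightarrow\gamma$ and $\beta\rightarrow\delta$. $\Diamond$-rule: $\mathbf{j}\rightarrow\Diamond\gamma$ ($\mathbf{j}$ a nominal) is replaced by $\mathbf{j}\rightarrow\Diamond\mathbf{k}$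 and $\mathbf{k}\rightarrow\gamma$, $\mathbf{k}$ a new nominal. Left-shift $\Box$-rule: $\gamma\rightarrow\Box\delta$ is replaced by $\Diamond^{ -1}\gamma\rightarrow\delta$. Ackermann-rule: if the equations of the system containing $p$ are exactly $\alpha_1\rightarrow p,\ldots,\alpha_n\rightarrow p$ with $p$ not occurring in $\alpha_1,\ldots,\alpha_n$, together with $\beta_1,\ldots,\beta_m$ each negative in $p$, these are replaced by $\beta_1[(\alpha_1\vee\cdots\vee\alpha_n)/p],\ldots,\beta_m[(\alpha_1\vee\cdots\vee\alpha_n)/p]$. -}

module Defs where

open import Data.Nat using (ℕ)
open import Data.Bool using (Bool; true; false; not)
open import Data.Product using (_×_; _,_; ∃; ∃-syntax; Σ-syntax)
open import Data.Sum using (_⊎_)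
open import Data.List using (List; []; _∷_; _++_; map)
open import Data.List.Membership.Propositional using (_∈_; _∉_)
open import Data.List.Relation.Unary.All using (All)
open import Data.List.Relation.Unary.Unique.Propositional using (Unique)
open import Relation.Nullary using (¬_)
open import Relation.Binary.PropositionalEquality using (_≡_)
open import Relation.Binary.Construct.Closure.ReflexiveTransitive using (Star)
open import Function.Bundles using (_⇔_)

Var : Set
Var = ℕ

Nom : Set
Nom = ℕ

data Fm : Set where
  ⊤′ ⊥′   : Fm
  var     : Var → Fm
  nom     : Nom → Fm
  ¬′_     : Fm → Fm
  _∧′_    : Fm → Fm → Fm
  _∨′_    : Fm → Fm → Fm
  ◇_      : Fm → Fm
  □_      : Fm → Fm
  ◇⁻_     : Fm → Fm
  □⁻_     : Fm → Fm

-- Occ p b φ : p has an occurrence in φ in the scope of an even (b = true)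
-- or odd (b = false) number of negations.
data Occ (p : Var) : Bool → Fm → Set where
  here : Occ p true (var p)
  ¬o   : ∀ {b φ} → Occ p b φ → Occ p (not b) (¬′ φ)
  ∧l   : ∀ {b φ ψ} → Occ p b φ → Occ p b (φ ∧′ ψ)
  ∧r   : ∀ {b φ ψ} → Occ p b ψ → Occ p b (φ ∧′ ψ)
  ∨l   : ∀ {b φ ψ} → Occ p b φ → Occ p b (φ ∨′ ψ)
  ∨r   : ∀ {b φ ψ} → Occ p b ψ → Occ p b (φ ∨′ ψ)
  ◇o   : ∀ {b φ} → Occ p b φ → Occ p b (◇ φ)
  □o   : ∀ {b φ} → Occ p b φ → Occ p b (□ φ)
  ◇⁻o  : ∀ {b φ} → Occ p b φ → Occ p b (◇⁻ φ)
  □⁻o  : ∀ {b φ} → Occ p b φ → Occ p b (□⁻ φ)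

data NomOcc (k : Nom) : Fm → Set where
  here : NomOcc k (nom k)
  ¬o   : ∀ {φ} → NomOcc k φ → NomOcc k (¬′ φ)
  ∧l   : ∀ {φ ψ} → NomOcc k φ → NomOcc k (φ ∧′ ψ)
  ∧r   : ∀ {φ ψ} → NomOcc k ψ → NomOcc k (φ ∧′ ψ)
  ∨l   : ∀ {φ ψ} → NomOcc k φ → NomOcc k (φ ∨′ ψ)
  ∨r   : ∀ {φ ψ} → NomOcc k ψ → NomOcc k (φ ∨′ ψ)
  ◇o   : ∀ {φ} → NomOcc k φ → NomOcc k (◇ φ)
  □o   : ∀ {φ} → NomOcc k φ → NomOcc k (□ φ)
  ◇⁻o  : ∀ {φ} → NomOcc k φ → NomOcc k (◇⁻ φ)
  □⁻o  : ∀ {φ} → NomOcc k φ → NomOcc k (□⁻ φ)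

Occurs : Var → Fm → Set
Occurs p φ = ∃[ b ] Occ p b φ

NegIn : Var → Fm → Set
NegIn p φ = ¬ Occ p true φ

Negative : Fm → Set
Negative φ = ∀ p → NegIn p φ

data BoxedAtom : Fm → Set where
  atom : ∀ q → BoxedAtom (var q)
  box  : ∀ {φ} → BoxedAtom φ → BoxedAtom (□ φ)

data SA : Fm → Set where
  sa⊤   : SA ⊤′
  sa⊥   : SA ⊥′
  saBox : ∀ {φ} → BoxedAtom φ → SA φ
  saNeg : ∀ {φ} → Negative φ → SA φ
  sa∧   : ∀ {φ ψ} → SA φ → SA ψ → SA (φ ∧′ ψ)
  sa◇   : ∀ {φ} → SA φ → SA (◇ φ)

_[_/_] : Fm → Fm → Var → Fm
⊤′ [ ψ / p ] = ⊤′
⊥′ [ ψ / p ] = ⊥′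
var q [ ψ / p ] with q Data.Nat.≟ p
... | Relation.Nullary.yes _ = ψ
... | Relation.Nullary.no _  = var q
nom j [ ψ / p ] = nom j
(¬′ φ) [ ψ / p ] = ¬′ (φ [ ψ / p ])
(φ ∧′ χ) [ ψ / p ] = (φ [ ψ / p ]) ∧′ (χ [ ψ / p ])
(φ ∨′ χ) [ ψ / p ] = (φ [ ψ / p ]) ∨′ (χ [ ψ / p ])
(◇ φ) [ ψ / p ] = ◇ (φ [ ψ / p ])
(□ φ) [ ψ / p ] = □ (φ [ ψ / p ])
(◇⁻ φ) [ ψ / p ] = ◇⁻ (φ [ ψ / p ])
(□⁻ φ) [ ψ / p ] = □⁻ (φ [ ψ / p ])

⋁ : List Fm → Fm
⋁ []           = ⊥′
⋁ (α ∷ [])     = α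
⋁ (α ∷ β ∷ αs) = α ∨′ ⋁ (β ∷ αs)

-- SQEMA-equations α → β, represented as the pair (α , β)
Eqn : Set
Eqn = Fm × Fm

-- systems: finite sets of equations, represented by lists up to SameSet
System : Set
System = List Eqn

SameSet : System → System → Set
SameSet E F = ∀ e → (e ∈ E) ⇔ (e ∈ F)

-- polarity of occurrences in the formula α → β (≡ ¬α ∨ β)
OccEq : Var → Bool → Eqn → Set
OccEq p b (α , β) = Occ p (not b) α ⊎ Occ p b β

OccursEq : Var → Eqn → Set
OccursEq p e = ∃[ b ] OccEq p b e

NegInEq : Var → Eqn → Set
NegInEq p e = ¬ OccEq p true e

NomOccEq : Nom → Eqn → Set
NomOccEq k (α , β) = NomOcc k α ⊎ NomOcc k β

FreshNom : Nom → System → Set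
FreshNom k E = All (λ e → ¬ NomOccEq k e) E

substEq : Var → Fm → Eqn → Eqn
substEq p ψ (α , β) = (α [ ψ / p ] , β [ ψ / p ])

data Rule : System → System → Set where
  ∧-rule : ∀ {β γ δ rest} → (β , γ ∧′ δ) ∉ rest →
           Rule ((β , γ ∧′ δ) ∷ rest) ((β , γ) ∷ (β , δ) ∷ rest)
  ◇-rule : ∀ {j γ k rest} → (nom j , ◇ γ) ∉ rest →
           FreshNom k ((nom j , ◇ γ) ∷ rest) →
           Rule ((nom j , ◇ γ) ∷ rest) ((nom j , ◇ (nom k)) ∷ (nom k , γ) ∷ rest)
  □-rule : ∀ {γ δ rest} → (γ , □ δ) ∉ rest →
           Rule ((γ , □ δ) ∷ rest) ((◇⁻ γ , δ) ∷ rest)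
  ack-rule : ∀ {p} (αs : List Fm) (βs rest : System) →
           Unique αs →
           All (λ α → ¬ Occurs p α) αs →
           All (NegInEq p) βs →
           All (λ e → ¬ OccursEq p e) rest →
           All (λ e → e ∉ rest) βs →
           Rule (map (λ α → (α , var p)) αs ++ βs ++ rest)
                (map (substEq p (⋁ αs)) βs ++ rest)

data Step (E E′ : System) : Set where
  step : ∀ {A B} → SameSet E A → Rule A B → SameSet B E′ → Step E E′

Steps : System → System → Set
Steps = Star Step

GoodEq : Eqn → Set
GoodEq e = ∃[ j ] ∃[ β ] (e ≡ (nom j , β) × SA β)

{-# OPTIONS --safe #-}
module Submission where

-- Every equation j → β in which p occurs positively is taken apart by the ∧-, ◇- and □-rules
-- until it reads α → p with α pure: a ∨-free Sahlqvist antecedent has positive p only under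
-- ∧, ◇ and boxes, and j → □ⁿ p ends as ◇⁻ⁿ j → p.  All other equations are j → β with β
-- negative in p, so one application of the Ackermann rule substitutes the pure disjunction ψ
-- of the α's for p.  Since ψ is pure, a boxed p becomes a pure, hence negative, formula, and
-- every β[ψ/p] is again a ∨-free Sahlqvist antecedent, now without p.  The decomposition
-- terminates because the total size of the right-hand sides with a positive p decreases.

open import Defs
open import Data.Bool using (true; false; not; if_then_else_)
open import Data.Bool.Properties using (not-involutive)
open import Data.Nat as ℕ using (ℕ; suc; _+_; _⊔_; _≤_; _<_; z≤n; s≤s)
open import Data.Nat.Properties
  using (≤-refl; ≤-reflexive; ≤-trans; <⇒≱; m⊔n<o⇒m<o; m⊔n<o⇒n<o; +-mono-≤; +-monoʳ-≤; +-monoˡ-<; +-identityʳ;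
         +-commutativeSemigroup; m≤n+m; module ≤-Reasoning)
open import Data.Nat.Induction using (<-wellFounded)
open import Data.Nat.ListAction using (sum)
open import Data.Nat.ListAction.Properties using (sum-++)
open import Algebra.Properties.CommutativeSemigroup +-commutativeSemigroup using (x∙yz≈y∙xz)
open import Data.Product using (_×_; _,_; ∃₂; ∃-syntax; proj₁; proj₂)
import Data.Product as Product
open import Data.Product.Properties using () renaming (≡-dec to ×-≡-dec)
open import Data.Sum using (_⊎_; inj₁; inj₂; [_,_]′)
import Data.Sum as Sum
open import Data.Empty using (⊥-elim)
open import Data.List using (List; []; _∷_; [_]; _++_; map; filter; deduplicate)
open import Data.List.Properties using (∷-injectiveˡ; map-++; ++-identityʳ) renaming (≡-dec to List-≡-dec)
open import Data.List.Membership.Propositional using (_∈_; _∉_; find)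
open import Data.List.Membership.Propositional.Properties using (∈-filter⁺; ∈-filter⁻; ∈-deduplicate⁺; ∈-deduplicate⁻)
open import Data.List.Relation.Unary.Any using (Any; here; there)
open import Data.List.Relation.Unary.All using (All; []; _∷_)
import Data.List.Relation.Unary.All as All
open import Data.List.Relation.Unary.All.Properties using (anti-mono; ++⁺) renaming (map⁺ to All-map⁺)
open import Data.List.Relation.Unary.Unique.DecPropositional.Properties using (deduplicate-!)
open import Data.List.Relation.Binary.Subset.Propositional using (_⊆_)
open import Data.List.Relation.Binary.Subset.Propositional.Properties
  using (⊆-trans; ⊆-reflexive; ⊆-reflexive-↭; ∈-∷⁺ʳ; xs⊆xs++ys; filter-⊆)
  renaming (map⁺ to ⊆-map⁺; ++⁺ to ⊆-++⁺)
open import Data.List.Relation.Binary.Permutation.Propositional using (_↭_; ↭-refl; ↭-sym; ↭-trans; prep)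
open import Data.List.Relation.Binary.Permutation.Propositional.Properties using (shift)
open import Induction.WellFounded using (Acc; acc)
open import Relation.Binary.Construct.On using (wellFounded)
open import Function using (_∘_; _on_)
open import Function.Bundles using (mk⇔)
open import Relation.Nullary using (¬_; Dec; yes; no; does; ¬?)
open import Relation.Nullary.Decidable using (map′; dec-true; toSum; _⊎-dec_)
open import Relation.Binary.Definitions using (DecidableEquality)
open import Relation.Binary.PropositionalEquality using (_≡_; _≢_; refl; sym; trans; cong; subst; module ≡-Reasoning)
open import Relation.Binary.Construct.Closure.ReflexiveTransitive using (ε; _◅_; _◅◅_)

-- Formulae are coded in reverse Polish notation over (tag, payload) symbols; a stack machine
-- reads a code back, so coding is injective and equality of formulae is decided on codes.
Symbol : Set
Symbol = ℕ × ℕ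

rpn : Fm → List Symbol → List Symbol
rpn ⊤′       = (0 , 0) ∷_
rpn ⊥′       = (1 , 0) ∷_
rpn (var q)  = (2 , q) ∷_
rpn (nom j)  = (3 , j) ∷_
rpn (¬′ φ)   = rpn φ ∘ ((4 , 0) ∷_)
rpn (φ ∧′ ψ) = rpn φ ∘ rpn ψ ∘ ((5 , 0) ∷_)
rpn (φ ∨′ ψ) = rpn φ ∘ rpn ψ ∘ ((6 , 0) ∷_)
rpn (◇ φ)    = rpn φ ∘ ((7 , 0) ∷_)
rpn (□ φ)    = rpn φ ∘ ((8 , 0) ∷_)
rpn (◇⁻ φ)   = rpn φ ∘ ((9 , 0) ∷_)
rpn (□⁻ φ)   = rpn φ ∘ ((10 , 0) ∷_)

push : Symbol → List Fm → List Fm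
push (0 , _)  st           = ⊤′ ∷ st
push (1 , _)  st           = ⊥′ ∷ st
push (2 , q)  st           = var q ∷ st
push (3 , j)  st           = nom j ∷ st
push (4 , _)  (φ ∷ st)     = ¬′ φ ∷ st
push (5 , _)  (ψ ∷ φ ∷ st) = φ ∧′ ψ ∷ st
push (6 , _)  (ψ ∷ φ ∷ st) = φ ∨′ ψ ∷ st
push (7 , _)  (φ ∷ st)     = ◇ φ ∷ st
push (8 , _)  (φ ∷ st)     = □ φ ∷ st
push (9 , _)  (φ ∷ st)     = ◇⁻ φ ∷ st
push (10 , _) (φ ∷ st)     = □⁻ φ ∷ st
push _        st           = st

run : List Fm → List Symbol → List Fm
run st []       = st
run st (s ∷ xs) = run (push s st) xs

run-rpn : ∀ φ st xs → run st (rpn φ xs) ≡ run (φ ∷ st) xs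
run-rpn ⊤′       st xs = refl
run-rpn ⊥′       st xs = refl
run-rpn (var q)  st xs = refl
run-rpn (nom j)  st xs = refl
run-rpn (¬′ φ)   st xs = run-rpn φ st _
run-rpn (φ ∧′ ψ) st xs = trans (run-rpn φ st _) (run-rpn ψ (φ ∷ st) _)
run-rpn (φ ∨′ ψ) st xs = trans (run-rpn φ st _) (run-rpn ψ (φ ∷ st) _)
run-rpn (◇ φ)    st xs = run-rpn φ st _
run-rpn (□ φ)    st xs = run-rpn φ st _
run-rpn (◇⁻ φ)   st xs = run-rpn φ st _
run-rpn (□⁻ φ)   st xs = run-rpn φ st _

rpn-injective : ∀ {φ ψ} → rpn φ [] ≡ rpn ψ [] → φ ≡ ψ
rpn-injective {φ} {ψ} eq = ∷-injectiveˡ (begin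
  [ φ ]             ≡⟨ sym (run-rpn φ [] []) ⟩
  run [] (rpn φ []) ≡⟨ cong (run []) eq ⟩
  run [] (rpn ψ []) ≡⟨ run-rpn ψ [] [] ⟩
  [ ψ ]             ∎)
  where open ≡-Reasoning

_≟ᶠ_ : DecidableEquality Fm
φ ≟ᶠ ψ = map′ rpn-injective (cong (λ χ → rpn χ [])) (List-≡-dec (×-≡-dec ℕ._≟_ ℕ._≟_) (rpn φ []) (rpn ψ []))

_≟ᵉ_ : DecidableEquality Eqn
_≟ᵉ_ = ×-≡-dec _≟ᶠ_ _≟ᶠ_

occ-¬⁺ : ∀ {p b φ} → Occ p (not b) φ → Occ p b (¬′ φ)
occ-¬⁺ {p} {b} {φ} o = subst (λ c → Occ p c (¬′ φ)) (not-involutive b) (¬o o)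

occ-¬⁻ : ∀ {p b φ} → Occ p b (¬′ φ) → Occ p (not b) φ
occ-¬⁻ {p} {φ = φ} (¬o {b} o) = subst (λ c → Occ p c φ) (sym (not-involutive b)) o

occ? : ∀ p b φ → Dec (Occ p b φ)
occ? p b     ⊤′       = no λ ()
occ? p b     ⊥′       = no λ ()
occ? p true  (var q)  = map′ (λ { refl → here }) (λ { here → refl }) (q ℕ.≟ p)
occ? p false (var q)  = no λ ()
occ? p b     (nom j)  = no λ ()
occ? p b     (¬′ φ)   = map′ occ-¬⁺ occ-¬⁻ (occ? p (not b) φ)
occ? p b     (φ ∧′ ψ) = map′ [ ∧l , ∧r ]′ (λ { (∧l o) → inj₁ o ; (∧r o) → inj₂ o }) (occ? p b φ ⊎-dec occ? p b ψ)
occ? p b     (φ ∨′ ψ) = map′ [ ∨l , ∨r ]′ (λ { (∨l o) → inj₁ o ; (∨r o) → inj₂ o }) (occ? p b φ ⊎-dec occ? p b ψ)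
occ? p b     (◇ φ)    = map′ ◇o (λ { (◇o o) → o }) (occ? p b φ)
occ? p b     (□ φ)    = map′ □o (λ { (□o o) → o }) (occ? p b φ)
occ? p b     (◇⁻ φ)   = map′ ◇⁻o (λ { (◇⁻o o) → o }) (occ? p b φ)
occ? p b     (□⁻ φ)   = map′ □⁻o (λ { (□⁻o o) → o }) (occ? p b φ)

Pure : Fm → Set
Pure φ = ∀ q b → ¬ Occ q b φ

pure⇒negative : ∀ {φ} → Pure φ → Negative φ
pure⇒negative pφ q = pφ q true

pure-nom : ∀ j → Pure (nom j)
pure-nom j q b ()

pure-□ : ∀ {φ} → Pure φ → Pure (□ φ)
pure-□ pφ q b (□o o) = pφ q b o

pure-◇⁻ : ∀ {φ} → Pure φ → Pure (◇⁻ φ)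
pure-◇⁻ pφ q b (◇⁻o o) = pφ q b o

pure-⋁ : ∀ {φs} → All Pure φs → Pure (⋁ φs)
pure-⋁ []                    q b ()
pure-⋁ (pφ ∷ [])             = pφ
pure-⋁ (pφ ∷ pψ ∷ pφs) q b (∨l o) = pφ q b o
pure-⋁ (pφ ∷ pψ ∷ pφs) q b (∨r o) = pure-⋁ (pψ ∷ pφs) q b o

occ-subst⁻ : ∀ {p ψ q b} → Pure ψ → ∀ φ → Occ q b (φ [ ψ / p ]) → q ≢ p × Occ q b φ
occ-subst⁻ {p} pψ (var r) o with r ℕ.≟ p
occ-subst⁻ pψ (var r) o  | yes _   = ⊥-elim (pψ _ _ o)
occ-subst⁻ pψ (var r) here | no r≢p = r≢p , here
occ-subst⁻ pψ (¬′ φ)   (¬o o)  = Product.map₂ ¬o (occ-subst⁻ pψ φ o)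
occ-subst⁻ pψ (φ ∧′ χ) (∧l o)  = Product.map₂ ∧l (occ-subst⁻ pψ φ o)
occ-subst⁻ pψ (φ ∧′ χ) (∧r o)  = Product.map₂ ∧r (occ-subst⁻ pψ χ o)
occ-subst⁻ pψ (φ ∨′ χ) (∨l o)  = Product.map₂ ∨l (occ-subst⁻ pψ φ o)
occ-subst⁻ pψ (φ ∨′ χ) (∨r o)  = Product.map₂ ∨r (occ-subst⁻ pψ χ o)
occ-subst⁻ pψ (◇ φ)    (◇o o)  = Product.map₂ ◇o (occ-subst⁻ pψ φ o)
occ-subst⁻ pψ (□ φ)    (□o o)  = Product.map₂ □o (occ-subst⁻ pψ φ o)
occ-subst⁻ pψ (◇⁻ φ)   (◇⁻o o) = Product.map₂ ◇⁻o (occ-subst⁻ pψ φ o)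
occ-subst⁻ pψ (□⁻ φ)   (□⁻o o) = Product.map₂ □⁻o (occ-subst⁻ pψ φ o)

boxedAtom-subst : ∀ {p ψ φ} → Pure ψ → BoxedAtom φ → BoxedAtom (φ [ ψ / p ]) ⊎ Pure (φ [ ψ / p ])
boxedAtom-subst {p} pψ (atom q) with q ℕ.≟ p
... | yes _ = inj₂ pψ
... | no _  = inj₁ (atom q)
boxedAtom-subst pψ (box b) = Sum.map box pure-□ (boxedAtom-subst pψ b)

sa-subst : ∀ {p ψ φ} → Pure ψ → SA φ → SA (φ [ ψ / p ])
sa-subst pψ sa⊤         = sa⊤
sa-subst pψ sa⊥         = sa⊥
sa-subst pψ (saBox b)   = [ saBox , saNeg ∘ pure⇒negative ]′ (boxedAtom-subst pψ b)
sa-subst {φ = φ} pψ (saNeg n) = saNeg λ q o → n q (proj₂ (occ-subst⁻ pψ φ o))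
sa-subst pψ (sa∧ a b)   = sa∧ (sa-subst pψ a) (sa-subst pψ b)
sa-subst pψ (sa◇ a)     = sa◇ (sa-subst pψ a)

data BoxedVar (q : Var) : Fm → Set where
  atom : BoxedVar q (var q)
  box  : ∀ {φ} → BoxedVar q φ → BoxedVar q (□ φ)

boxedAtom-occ : ∀ {p b φ} → BoxedAtom φ → Occ p b φ → BoxedVar p φ
boxedAtom-occ (atom _) here   = atom
boxedAtom-occ (box a)  (□o o) = box (boxedAtom-occ a o)

boxedVar-occ : ∀ {p φ} → BoxedVar p φ → Occ p true φ
boxedVar-occ atom    = here
boxedVar-occ (box b) = □o (boxedVar-occ b)

size : Fm → ℕ
size ⊤′       = 0
size ⊥′       = 0
size (var _)  = 0
size (nom _)  = 0
size (¬′ φ)   = suc (size φ)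
size (φ ∧′ ψ) = suc (size φ + size ψ)
size (φ ∨′ ψ) = suc (size φ + size ψ)
size (◇ φ)    = suc (size φ)
size (□ φ)    = suc (size φ)
size (◇⁻ φ)   = suc (size φ)
size (□⁻ φ)   = suc (size φ)

maxNom : Fm → ℕ
maxNom ⊤′       = 0
maxNom ⊥′       = 0
maxNom (var _)  = 0
maxNom (nom j)  = j
maxNom (¬′ φ)   = maxNom φ
maxNom (φ ∧′ ψ) = maxNom φ ⊔ maxNom ψ
maxNom (φ ∨′ ψ) = maxNom φ ⊔ maxNom ψ
maxNom (◇ φ)    = maxNom φ
maxNom (□ φ)    = maxNom φ
maxNom (◇⁻ φ)   = maxNom φ
maxNom (□⁻ φ)   = maxNom φ

maxNom-fresh : ∀ {k} φ → maxNom φ < k → ¬ NomOcc k φ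
maxNom-fresh (nom j)  j<j here      = <⇒≱ j<j ≤-refl
maxNom-fresh (¬′ φ)   lt  (¬o o)    = maxNom-fresh φ lt o
maxNom-fresh (φ ∧′ ψ) lt  (∧l o)    = maxNom-fresh φ (m⊔n<o⇒m<o _ _ lt) o
maxNom-fresh (φ ∧′ ψ) lt  (∧r o)    = maxNom-fresh ψ (m⊔n<o⇒n<o _ _ lt) o
maxNom-fresh (φ ∨′ ψ) lt  (∨l o)    = maxNom-fresh φ (m⊔n<o⇒m<o _ _ lt) o
maxNom-fresh (φ ∨′ ψ) lt  (∨r o)    = maxNom-fresh ψ (m⊔n<o⇒n<o _ _ lt) o
maxNom-fresh (◇ φ)    lt  (◇o o)    = maxNom-fresh φ lt o
maxNom-fresh (□ φ)    lt  (□o o)    = maxNom-fresh φ lt o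
maxNom-fresh (◇⁻ φ)   lt  (◇⁻o o)   = maxNom-fresh φ lt o
maxNom-fresh (□⁻ φ)   lt  (□⁻o o)   = maxNom-fresh φ lt o

module Removal {A : Set} (_≟_ : DecidableEquality A) where

  remove : A → List A → List A
  remove x = filter (λ y → ¬? (y ≟ x))

  remove-∉ : ∀ {x} xs → x ∉ remove x xs
  remove-∉ xs x∈ = proj₂ (∈-filter⁻ (λ y → ¬? (y ≟ _)) {xs = xs} x∈) refl

  remove-⊆ : ∀ {x} xs → remove x xs ⊆ xs
  remove-⊆ xs = filter-⊆ (λ y → ¬? (y ≟ _)) xs

  ⊆-∷-remove : ∀ {x} xs → xs ⊆ x ∷ remove x xs
  ⊆-∷-remove {x} xs {y} y∈ with y ≟ x
  ... | yes refl = here refl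
  ... | no y≢x   = there (∈-filter⁺ (λ y → ¬? (y ≟ x)) y∈ y≢x)

  sum-remove-≤ : ∀ (f : A → ℕ) x xs → sum (map f (remove x xs)) ≤ sum (map f xs)
  sum-remove-≤ f x []       = z≤n
  sum-remove-≤ f x (y ∷ xs) with y ≟ x
  ... | yes _ = ≤-trans (sum-remove-≤ f x xs) (m≤n+m _ (f y))
  ... | no _  = +-monoʳ-≤ (f y) (sum-remove-≤ f x xs)

  sum-remove : ∀ (f : A → ℕ) {x} xs → x ∈ xs → f x + sum (map f (remove x xs)) ≤ sum (map f xs)
  sum-remove f {x} (y ∷ xs) x∈ with y ≟ x | x∈
  ... | yes refl | _         = +-monoʳ-≤ (f x) (sum-remove-≤ f x xs)
  ... | no y≢x   | here x≡y  = ⊥-elim (y≢x (sym x≡y))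
  ... | no _     | there x∈′ =
    ≤-trans (≤-reflexive (x∙yz≈y∙xz (f x) (f y) _)) (+-monoʳ-≤ (f y) (sum-remove f xs x∈′))

open Removal _≟ᵉ_

all⊎any : ∀ {A : Set} {P Q : A → Set} {xs} → All (λ x → P x ⊎ Q x) xs → All P xs ⊎ Any Q xs
all⊎any []               = inj₁ []
all⊎any (inj₂ qx ∷ pqxs) = inj₂ (here qx)
all⊎any (inj₁ px ∷ pqxs) = Sum.map (px ∷_) there (all⊎any pqxs)

SameSet-refl : ∀ {E} → SameSet E E
SameSet-refl _ = mk⇔ (λ e∈ → e∈) (λ e∈ → e∈)

⊆-antisym⇒SameSet : ∀ {E F} → E ⊆ F → F ⊆ E → SameSet E F
⊆-antisym⇒SameSet E⊆F F⊆E _ = mk⇔ E⊆F F⊆E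

maxNomˢ : System → ℕ
maxNomˢ []            = 0
maxNomˢ ((α , β) ∷ E) = maxNom α ⊔ maxNom β ⊔ maxNomˢ E

freshNom : System → Nom
freshNom E = suc (maxNomˢ E)

maxNomˢ-fresh : ∀ {k} E → maxNomˢ E < k → FreshNom k E
maxNomˢ-fresh []            _  = []
maxNomˢ-fresh ((α , β) ∷ E) lt =
  [ maxNom-fresh α (m⊔n<o⇒m<o _ _ lt₁) , maxNom-fresh β (m⊔n<o⇒n<o _ _ lt₁) ]′
  ∷ maxNomˢ-fresh E (m⊔n<o⇒n<o _ _ lt)
  where lt₁ = m⊔n<o⇒m<o _ _ lt

freshNom-fresh : ∀ E → FreshNom (freshNom E) E
freshNom-fresh E = maxNomˢ-fresh E ≤-refl

_⇝⟨_⟩_ : Eqn → Nom → System → Set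
e ⇝⟨ k ⟩ new = ∀ {rest} → e ∉ rest → FreshNom k (e ∷ rest) → Rule (e ∷ rest) (new ++ rest)

step-at : ∀ {E e new} → e ∈ E → e ⇝⟨ freshNom E ⟩ new → Step E (new ++ remove e E)
step-at {E} e∈E e⇝new =
  step (⊆-antisym⇒SameSet (⊆-∷-remove E) e∷rest⊆E)
       (e⇝new (remove-∉ E) (anti-mono e∷rest⊆E (freshNom-fresh E)))
       SameSet-refl
  where e∷rest⊆E = ∈-∷⁺ʳ e∈E (remove-⊆ E)

module Elimination (p : Var) where

  weight : Fm → ℕ
  weight φ = if does (occ? p true φ) then size φ else 0

  weight≤size : ∀ φ → weight φ ≤ size φ
  weight≤size φ with does (occ? p true φ)
  ... | true  = ≤-refl
  ... | false = z≤n

  weight-occ : ∀ {φ} → Occ p true φ → weight φ ≡ size φ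
  weight-occ {φ} o rewrite dec-true (occ? p true φ) o = refl

  weightEq : Eqn → ℕ
  weightEq (_ , β) = weight β

  weights : System → ℕ
  weights E = sum (map weightEq E)

  data Pending : Eqn → Set where
    sahlqvist : ∀ {j β} → SA β → Pending (nom j , β)
    boxed     : ∀ {α φ} → Pure α → BoxedVar p φ → Pending (α , φ)

  good⇒pending : ∀ {e} → GoodEq e → Pending e
  good⇒pending (_ , _ , refl , sa) = sahlqvist sa

  data PositiveEq : Eqn → Set where
    positive : ∀ {α} → Pure α → PositiveEq (α , var p)

  data NegativeEq : Eqn → Set where
    negative : ∀ {j β} → SA β → NegIn p β → NegativeEq (nom j , β)

  Finished : Eqn → Set
  Finished e = PositiveEq e ⊎ NegativeEq e

  Reduces : Nom → Eqn → Set
  Reduces k e = ∃[ new ] (e ⇝⟨ k ⟩ new × All Pending new × weights new < weightEq e)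

  □-reduces : ∀ {k α φ} → Pure α → BoxedVar p φ → Reduces k (α , □ φ)
  □-reduces {φ = φ} pα b =
    _ , (λ e∉ _ → □-rule e∉) , boxed (pure-◇⁻ pα) b ∷ [] , decreases
    where
    decreases : weight φ + 0 < weight (□ φ)
    decreases rewrite weight-occ (□o (boxedVar-occ b)) | +-identityʳ (weight φ) = s≤s (weight≤size φ)

  ∧-reduces : ∀ {k j γ δ} → SA γ → SA δ → Occ p true (γ ∧′ δ) → Reduces k (nom j , γ ∧′ δ)
  ∧-reduces {γ = γ} {δ} a b o =
    _ , (λ e∉ _ → ∧-rule e∉) , sahlqvist a ∷ sahlqvist b ∷ [] , decreases
    where
    decreases : weight γ + (weight δ + 0) < weight (γ ∧′ δ)
    decreases rewrite weight-occ o | +-identityʳ (weight δ) =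
      s≤s (+-mono-≤ (weight≤size γ) (weight≤size δ))

  ◇-reduces : ∀ {k j γ} → SA γ → Occ p true (◇ γ) → Reduces k (nom j , ◇ γ)
  ◇-reduces {k} {γ = γ} a o =
    _ , ◇-rule ,
    sahlqvist (sa◇ (saNeg (pure⇒negative (pure-nom k)))) ∷ sahlqvist a ∷ [] , decreases
    where
    -- weight (◇ nom k) computes to 0, as occ? decides the absence of p by evaluation.
    decreases : weight (◇ nom k) + (weight γ + 0) < weight (◇ γ)
    decreases rewrite weight-occ o | +-identityʳ (weight γ) = s≤s (weight≤size γ)

  sahlqvist-progress : ∀ k {j β} → SA β → Occ p true β → Finished (nom j , β) ⊎ Reduces k (nom j , β)
  sahlqvist-progress k     (saNeg n)        o      = ⊥-elim (n p o)
  sahlqvist-progress k {j} (saBox (atom _)) here  = inj₁ (inj₁ (positive (pure-nom j)))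
  sahlqvist-progress k {j} (saBox (box a))  (□o o) = inj₂ (□-reduces (pure-nom j) (boxedAtom-occ a o))
  sahlqvist-progress k     (sa∧ a b)        o      = inj₂ (∧-reduces a b o)
  sahlqvist-progress k     (sa◇ a)          o      = inj₂ (◇-reduces a o)

  progress : ∀ k {e} → Pending e → Finished e ⊎ Reduces k e
  progress k (boxed pα atom)    = inj₁ (inj₁ (positive pα))
  progress k (boxed pα (box b)) = inj₂ (□-reduces pα b)
  progress k (sahlqvist sa) =
    [ sahlqvist-progress k sa , inj₁ ∘ inj₂ ∘ negative sa ]′ (toSum (occ? p true _))

  weights-step : ∀ {E e new} → e ∈ E → weights new < weightEq e →
                 weights (new ++ remove e E) < weights E
  weights-step {E} {e} {new} e∈E lt = begin-strict
    weights (new ++ remove e E)                         ≡⟨ cong sum (map-++ weightEq new _) ⟩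
    sum (map weightEq new ++ map weightEq (remove e E)) ≡⟨ sum-++ (map weightEq new) _ ⟩
    weights new + weights (remove e E)                  <⟨ +-monoˡ-< _ lt ⟩
    weightEq e + weights (remove e E)                   ≤⟨ sum-remove weightEq E e∈E ⟩
    weights E                                           ∎
    where open ≤-Reasoning

  normalise : ∀ {E} → Acc (_<_ on weights) E → All Pending E → ∃[ F ] (Steps E F × All Finished F)
  normalise {E} (acc smaller) pend with all⊎any (All.map (progress (freshNom E)) pend)
  ... | inj₁ finished = E , ε , finished
  ... | inj₂ reducible =
    let e , e∈E , new , e⇝new , pend-new , lt = find reducible
        F , E⇝F , finished = normalise (smaller (weights-step {new = new} e∈E lt))
                                       (++⁺ pend-new (anti-mono (remove-⊆ E) pend))
    in F , step-at e∈E e⇝new ◅ E⇝F , finished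

  ⟨_⟩→p : Fm → Eqn
  ⟨ α ⟩→p = α , var p

  split : ∀ {F} → All Finished F →
          ∃₂ λ αs βs → All Pure αs × All NegativeEq βs × F ↭ map ⟨_⟩→p αs ++ βs
  split [] = [] , [] , [] , [] , ↭-refl
  split (inj₁ (positive {α} pα) ∷ fs) =
    let αs , βs , pαs , nβs , F↭ = split fs
    in α ∷ αs , βs , pα ∷ pαs , nβs , prep _ F↭
  split (inj₂ n ∷ fs) =
    let αs , βs , pαs , nβs , F↭ = split fs
    in αs , _ ∷ βs , pαs , n ∷ nβs , ↭-trans (prep _ F↭) (↭-sym (shift _ (map ⟨_⟩→p αs) βs))

  substituted-good : ∀ {ψ e} → Pure ψ → NegativeEq e → GoodEq (substEq p ψ e)
  substituted-good pψ (negative {j} {β} sa _) = j , β [ _ / p ] , refl , sa-subst pψ sa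

  substituted-free : ∀ {ψ e} → Pure ψ → NegativeEq e → ¬ OccursEq p (substEq p ψ e)
  substituted-free pψ (negative {β = β} _ _) (_ , inj₂ o) = proj₁ (occ-subst⁻ pψ β o) refl

  negInEq : ∀ {e} → NegativeEq e → NegInEq p e
  negInEq (negative _ p∉β) = [ (λ ()) , p∉β ]′

  ackermann : ∀ {F αs βs} → All Pure αs → All NegativeEq βs → F ↭ map ⟨_⟩→p αs ++ βs →
              ∃[ E′ ] (Step F E′ × All GoodEq E′ × All (λ e → ¬ OccursEq p e) E′)
  ackermann {F} {αs} {βs} pαs nβs F↭ =
    _ , step F≈A (ack-rule αs′ βs [] (deduplicate-! _≟ᶠ_ αs) (All.map (λ pα (b , o) → pα p b o) pαs′)
                   (All.map negInEq nβs) [] (All.tabulate (λ _ ())))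
             SameSet-refl ,
    ++⁺ (All-map⁺ (All.map (substituted-good pψ) nβs)) [] ,
    ++⁺ (All-map⁺ (All.map (substituted-free pψ) nβs)) []
    where
    αs′ = deduplicate _≟ᶠ_ αs
    pαs′ : All Pure αs′
    pαs′ = anti-mono (∈-deduplicate⁻ _≟ᶠ_ αs) pαs
    pψ : Pure (⋁ αs′)
    pψ = pure-⋁ pαs′
    F≈A : SameSet F (map ⟨_⟩→p αs′ ++ βs ++ [])
    F≈A = ⊆-antisym⇒SameSet
      (⊆-trans (⊆-reflexive-↭ F↭) (⊆-++⁺ (⊆-map⁺ ⟨_⟩→p (∈-deduplicate⁺ _≟ᶠ_)) (xs⊆xs++ys βs [])))
      (⊆-trans (⊆-++⁺ (⊆-map⁺ ⟨_⟩→p (∈-deduplicate⁻ _≟ᶠ_ αs)) (⊆-reflexive (++-identityʳ βs)))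
               (⊆-reflexive-↭ (↭-sym F↭)))

  eliminate : ∀ {F} → All Finished F →
              ∃[ E′ ] (Step F E′ × All GoodEq E′ × All (λ e → ¬ OccursEq p e) E′)
  eliminate fs = let _ , _ , pαs , nβs , F↭ = split fs in ackermann pαs nβs F↭

lemma5p3 : (E : System) (p : Var) →
    All GoodEq E →
    (∃[ e ] (e ∈ E × OccEq p true e)) →
    (∃[ e ] (e ∈ E × OccEq p false e)) →
    ∃[ E′ ] (Steps E E′ × All GoodEq E′ × All (λ e → ¬ OccursEq p e) E′)
lemma5p3 E p good _ _ =
  let F , E⇝F , finished = normalise (wellFounded weights <-wellFounded E) (All.map good⇒pending good)
      E′ , F⇝E′ , good′ , p-free = eliminate finished
  in E′ , E⇝F ◅◅ F⇝E′ ◅ ε , good′ , p-free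
  where open Elimination p
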